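{- Let $\Sigma$ be a set and $A\subseteq\wp(\Sigma)$ a disjunctive abstract domain. Then for every $S\subseteq\Sigma$, $\mu_A(S)=\bigcup\{B\in\mathrm{pr}(A)\mid \exists C\in\mathrm{pr}(A).\ C\cap S\neq\varnothing\ \wedge\ B\unlhd_A C\}$.
   Context: An abstract domain is a set $A\subseteq\wp(\Sigma)$ closed under arbitrary intersections (so $\Sigma\in A$); it is disjunctive if moreover it is closed under arbitrary unions (so $\varnothing\in A$). $\mu_A(S)=\bigcap\{X\in A\mid S\subseteq X\}$. $\mathrm{pr}(A)$ is the partition of $\Sigma$ where $s,s'$ share a block iff $\mu_A(\{s\})=\mu_A(\{s'\})$. For $B_1,B_2\in\mathrm{pr}(A)$, $B_1\unlhd_A B_2$ iff $\mu_A(B_1)\subseteq\mu_A(B_2)$. -}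

module Defs where

open import Level using (Level; 0ℓ; suc; _⊔_)
open import Relation.Unary using (Pred; _⊆_; _≐_)
open import Relation.Binary.PropositionalEquality using (_≡_)
open import Data.Product using (Σ-syntax; ∃-syntax; _×_)
open import Function.Bundles using (_⇔_)

Subset : Set → Set₁
Subset Σ = Pred Σ 0ℓ

Family : Set → Set₁
Family Σ = Pred (Subset Σ) 0ℓ

module _ {Σ : Set} where

  -- Closure under arbitrary intersections: for every family of members of A
  -- (indexed by any I : Set₁, which covers all subfamilies of A), some
  -- member of A is (extensionally) equal to its intersection.
  ClosedUnderIntersections : Family Σ → Set₂
  ClosedUnderIntersections A =
    (I : Set₁) (f : I → Subset Σ) → (∀ i → A (f i)) →
    Σ[ X ∈ Subset Σ ] (A X × (∀ x → X x ⇔ (∀ i → f i x)))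

  ClosedUnderUnions : Family Σ → Set₂
  ClosedUnderUnions A =
    (I : Set₁) (f : I → Subset Σ) → (∀ i → A (f i)) →
    Σ[ X ∈ Subset Σ ] (A X × (∀ x → X x ⇔ (∃[ i ] f i x)))

  IsAbstractDomain : Family Σ → Set₂
  IsAbstractDomain A = ClosedUnderIntersections A

  IsDisjunctive : Family Σ → Set₂
  IsDisjunctive A = IsAbstractDomain A × ClosedUnderUnions A

  μ : {ℓ : Level} → Family Σ → Pred Σ ℓ → Pred Σ (suc 0ℓ ⊔ ℓ)
  μ A S x = (X : Subset Σ) → A X → S ⊆ X → X x

  ｛_｝ : Σ → Subset Σ
  ｛ s ｝ = λ x → x ≡ s

  -- B ∈ pr(A): B is the block of some s, i.e. B = { x | μ_A({x}) = μ_A({s}) }.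
  IsBlock : Family Σ → Pred Σ (suc 0ℓ) → Set₁
  IsBlock A B = ∃[ s ] (∀ x → B x ⇔ (μ A ｛ x ｝ ≐ μ A ｛ s ｝))

  _⊴[_]_ : Pred Σ (suc 0ℓ) → Family Σ → Pred Σ (suc 0ℓ) → Set₁
  B₁ ⊴[ A ] B₂ = μ A B₁ ⊆ μ A B₂

  -- ⋃ { B ∈ pr(A) | ∃ C ∈ pr(A). C ∩ S ≠ ∅ ∧ B ⊴_A C }
  -- (C ∩ S ≠ ∅ read constructively as: C ∩ S is inhabited)
  prUnion : Family Σ → Subset Σ → Pred Σ (suc (suc 0ℓ))
  prUnion A S x =
    ∃[ B ] (IsBlock A B × B x ×
      ∃[ C ] (IsBlock A C × (∃[ y ] (C y × S y)) × B ⊴[ A ] C))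

{-# OPTIONS --safe #-}
-- Blocks of pr(A) are exactly the sets of points that no member of A
-- separates, so a member of A meeting a block contains it.  Hence
-- C ∩ S ≠ ∅ forces C ⊆ μ_A(S), and B ⊴_A C then puts B in μ_A(S).
-- Conversely, in a disjunctive domain ⋃_{y ∈ S} μ_A({y}) belongs to A and
-- contains S, so each x ∈ μ_A(S) lies in some μ_A({y}) with y ∈ S, and
-- x ∈ μ_A({y}) makes the block of x ⊴_A the block of y.
module Submission where

open import Defs
open import Level using (Level; Lift; lift; 0ℓ; suc)
open import Relation.Unary using (Pred; _⊆_; _≐_)
open import Relation.Binary.PropositionalEquality using (refl)
open import Data.Product using (Σ-syntax; ∃; ∃-syntax; _×_; _,_; proj₁; proj₂)
open import Function using (id; _∘_)
open import Function.Bundles using (Equivalence; mk⇔)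

open Equivalence

module _ {Σ : Set} (A : Family Σ) where

  μ-extensive : {ℓ : Level} {S : Pred Σ ℓ} → S ⊆ μ A S
  μ-extensive Sx X _ S⊆X = S⊆X Sx

  μ｛｝⊆ : {X : Subset Σ} {y : Σ} → A X → X y → μ A ｛ y ｝ ⊆ X
  μ｛｝⊆ AX Xy μyx = μyx _ AX λ { refl → Xy }

  μ-representable : ClosedUnderIntersections A → (S : Subset Σ) →
                    Σ[ X ∈ Subset Σ ] (A X × X ≐ μ A S)
  μ-representable ⋂-closed S
    with ⋂-closed (Σ[ Y ∈ Subset Σ ] (A Y × S ⊆ Y)) proj₁ (proj₁ ∘ proj₂)
  ... | X , AX , X⇔⋂ =
    X , AX , (λ Xx Y AY S⊆Y → to (X⇔⋂ _) Xx (Y , AY , S⊆Y))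
           , (λ μSx → from (X⇔⋂ _) λ (Y , AY , S⊆Y) → μSx Y AY S⊆Y)

  module _ (⋂-closed : ClosedUnderIntersections A) where

    μ̂｛_｝ : Σ → Subset Σ
    μ̂｛ y ｝ = proj₁ (μ-representable ⋂-closed ｛ y ｝)

    A-μ̂｛｝ : (y : Σ) → A μ̂｛ y ｝
    A-μ̂｛｝ y = proj₁ (proj₂ (μ-representable ⋂-closed ｛ y ｝))

    μ̂｛｝≐μ｛｝ : (y : Σ) → μ̂｛ y ｝ ≐ μ A ｛ y ｝
    μ̂｛｝≐μ｛｝ y = proj₂ (proj₂ (μ-representable ⋂-closed ｛ y ｝))

    μ⊆⋃μ｛｝ : ClosedUnderUnions A → {S : Subset Σ} {x : Σ} →
              μ A S x → ∃[ y ] (S y × μ A ｛ y ｝ x)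
    μ⊆⋃μ｛｝ ⋃-closed {S} μSx
      with ⋃-closed (Lift (suc 0ℓ) (∃ S)) (λ (lift (y , _)) → μ̂｛ y ｝)
                                          (λ (lift (y , _)) → A-μ̂｛｝ y)
    ... | U , AU , U⇔⋃ with to (U⇔⋃ _) (μSx U AU S⊆U)
      where S⊆U : S ⊆ U
            S⊆U {y} Sy = from (U⇔⋃ y) (lift (y , Sy) , proj₂ (μ̂｛｝≐μ｛｝ y) (μ-extensive refl))
    ... | lift (y , Sy) , μ̂yx = y , Sy , proj₁ (μ̂｛｝≐μ｛｝ y) μ̂yx

  block : Σ → Pred Σ (suc 0ℓ)
  block s x = μ A ｛ x ｝ ≐ μ A ｛ s ｝

  block-isBlock : (s : Σ) → IsBlock A (block s)
  block-isBlock s = s , λ _ → mk⇔ id id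

  block-self : (s : Σ) → block s s
  block-self _ = id , id

  block-⊆ : {B : Pred Σ (suc 0ℓ)} {X : Subset Σ} {y : Σ} →
            IsBlock A B → A X → B y → X y → B ⊆ X
  block-⊆ {y = y} (s , B⇔) AX By Xy {x} Bx =
    μ｛｝⊆ AX Xy (proj₂ (to (B⇔ y) By) (proj₁ (to (B⇔ x) Bx) (μ-extensive refl)))

  μ｛｝⇒block-⊴ : {x y : Σ} → μ A ｛ y ｝ x → block x ⊴[ A ] block y
  μ｛｝⇒block-⊴ {x} {y} μyx μBz X AX C⊆X =
    μBz X AX (block-⊆ (block-isBlock x) AX (block-self x)
                      (μ｛｝⊆ AX (C⊆X (block-self y)) μyx))

  prUnion⊆μ : (S : Subset Σ) → prUnion A S ⊆ μ A S
  prUnion⊆μ S (B , _ , Bx , C , isC , (y , Cy , Sy) , B⊴C) X AX S⊆X =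
    B⊴C (μ-extensive Bx) X AX (block-⊆ isC AX Cy (S⊆X Sy))

  μ⊆prUnion : IsDisjunctive A → (S : Subset Σ) → μ A S ⊆ prUnion A S
  μ⊆prUnion (⋂-closed , ⋃-closed) S {x} μSx with μ⊆⋃μ｛｝ ⋂-closed ⋃-closed μSx
  ... | y , Sy , μyx =
    block x , block-isBlock x , block-self x ,
    block y , block-isBlock y , (y , block-self y , Sy) , μ｛｝⇒block-⊴ μyx

lemma5p2 : {Σ : Set} (A : Family Σ) → IsDisjunctive A →
    (S : Subset Σ) → μ A S ≐ prUnion A S
lemma5p2 A disj S = μ⊆prUnion A disj S , prUnion⊆μ A S
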